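{- Let $B=(X,Y,E)$ be a finite bipartite graph with parts $X$ and $Y$. Then the following are equivalent: (a) $B$ is a signed-interval bigraph; (b) $B$ has Ferrers dimension at most $2$.
   Context: A signed interval is a pair $I_v=[l(v),r(v)]$ of real numbers; it is positive (written $I_v^+$) if $l(v)\le r(v)$ and negative (written $I_v^-$) if $l(v)>r(v)$. For a positive $I_u^+$ and positive $I_v^+$, $I_u^+\cap I_v^+\neq\emptyset$ has the usual meaning (equivalently $l(u)\le r(v)$ and $l(v)\le r(u)$). For a negative $I_v^-$ and a positive $I_u^+$, $I_v^-\subseteq I_u^+$ means $l(u)\le r(v)$ and $l(v)\le r(u)$, i.e. the real interval $[r(v),l(v)]$ is contained in $[l(u),r(u)]$. A bipartite graph $B=(X,Y,E)$ is a signed-interval bigraph if one can assign to each vertex $v\in X\cup Y$ a signed interval $I_v$ (positive or negative) such that for $x\in X$, $y\in Y$: $xy\in E$ if and only if ($I_x^+\cap I_y^+\neq\emptyset$ with both positive) or ($I_x^-\subseteq I_y^+$) or ($I_y^-\subseteq I_x^+$). A Ferrers bigraph is a bipartite graph $(X,Y,F)$ in which the neighbourhoods of the vertices of $X$ are linearly ordered by inclusion (equivalently, its biadjacency matrix contains no $2\times 2$ permutation submatrix). The Ferrers dimension of $B=(X,Y,E)$ is the minimum number $k$ of Ferrers bigraphs $(X,Y,F_1),\dots,(X,Y,F_k)$ with $E=F_1\cap\dots\cap F_k$. Equivalently, $B$ has Ferrers dimension at most $2$ iff the rows and columns of its biadjacency matrix can be permuted independently so that no $0$ entry has a $1$ both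 below it (in its column) and to its right (in its row).
   Formalization: The endpoints of the signed intervals are taken in the rationals instead of the real numbers. -}

module Defs where

open import Data.Nat using (ℕ)
open import Data.Fin using (Fin)
open import Data.Bool using (Bool; true; _∧_)
open import Data.Rational using (ℚ; _≤_; _<_)
open import Data.Product using (_×_; Σ; Σ-syntax)
open import Data.Sum using (_⊎_)
open import Relation.Binary.PropositionalEquality using (_≡_)

BiGraph : ℕ → ℕ → Set
BiGraph m n = Fin m → Fin n → Bool

record SInterval : Set where
  constructor [_,_]
  field
    l : ℚ
    r : ℚ
open SInterval public

Positive : SInterval → Set
Positive I = l I ≤ r I

Negative : SInterval → Set
Negative I = r I < l I

Meets : SInterval → SInterval → Set
Meets Iu Iv = (l Iu ≤ r Iv) × (l Iv ≤ r Iu)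

-- I_v^- ⊆ I_u^+ :  l(u) ≤ r(v) and l(v) ≤ r(u)
NegInside : SInterval → SInterval → Set
NegInside Iv Iu = (l Iu ≤ r Iv) × (l Iv ≤ r Iu)

SAdj : SInterval → SInterval → Set
SAdj Ix Iy =
    (Positive Ix × Positive Iy × Meets Ix Iy)
  ⊎ (Negative Ix × Positive Iy × NegInside Ix Iy)
  ⊎ (Negative Iy × Positive Ix × NegInside Iy Ix)

IsSignedIntervalBigraph : ∀ {m n} → BiGraph m n → Set
IsSignedIntervalBigraph {m} {n} E =
  Σ[ I ∈ (Fin m → SInterval) ] Σ[ J ∈ (Fin n → SInterval) ]
    (∀ x y → (E x y ≡ true → SAdj (I x) (J y)) × (SAdj (I x) (J y) → E x y ≡ true))

IsFerrers : ∀ {m n} → BiGraph m n → Set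
IsFerrers {m} {n} F =
  ∀ (x x′ : Fin m) →
    (∀ (y : Fin n) → F x y ≡ true → F x′ y ≡ true)
    ⊎ (∀ (y : Fin n) → F x′ y ≡ true → F x y ≡ true)

-- Ferrers dimension at most 2: E = F₁ ∩ F₂ with F₁, F₂ Ferrers bigraphs on (X, Y).
-- (Dimension 0 or 1 is subsumed: repeat a factor / use the complete bigraph.)
FerrersDim≤2 : ∀ {m n} → BiGraph m n → Set
FerrersDim≤2 {m} {n} E =
  Σ[ F₁ ∈ BiGraph m n ] Σ[ F₂ ∈ BiGraph m n ]
    IsFerrers F₁ × IsFerrers F₂ × (∀ x y → E x y ≡ (F₁ x y ∧ F₂ x y))

-- Whatever the signs of I and J, SAdj I J says exactly l I ≤ r J and l J ≤ r I
-- (two negative intervals can never satisfy both).  So a signed-interval bigraph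
-- is the intersection of the two threshold bigraphs "l(I x) ≤ r(J y)" and
-- "l(J y) ≤ r(I x)", and threshold bigraphs are precisely the Ferrers bigraphs:
-- a threshold relation is Ferrers because the weights are totally ordered, and
-- conversely in a Ferrers bigraph neighbourhoods are ordered by their sizes,
-- so x ~ y iff |N(x)| is at least the smallest |N(x′)| over the neighbours x′
-- of y.  Negating one coordinate turns two threshold representations into
-- intervals.

module Submission where

open import Defs
open import Data.Nat using (ℕ)
open import Function.Bundles using (_⇔_)

open import Level using (Level; 0ℓ)
open import Function using (_∘_; id; flip)
open import Function.Bundles using (mk⇔; Equivalence)
open import Function.Properties.Equivalence using (⇔-setoid)
open import Function.Construct.Composition using (_⇔-∘_)
open import Data.Bool using (Bool; true; false; _∧_; _≟_)
open import Data.Bool.Properties using (⇔→≡)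
open import Data.Product using (_×_; _,_; Σ-syntax; uncurry)
open import Data.Product.Function.NonDependent.Propositional using (_×-⇔_)
open import Data.Sum using (_⊎_; inj₁; inj₂)
import Data.Sum as Sum
open import Data.Fin using (Fin)
open import Data.Fin.Subset using (Subset; _⊆_; ∣_∣)
import Data.Fin.Subset as Subset
open import Data.Fin.Subset.Properties using (_∈?_; p⊂q⇒∣p∣<∣q∣; ∣p∣≤n)
open import Data.Vec using (tabulate)
open import Data.Vec.Properties using (lookup∘tabulate; []=⇒lookup; lookup⇒[]=)
open import Data.List using (List; map; filter; allFin)
import Data.List.Relation.Unary.All as All
open import Data.List.Membership.Propositional.Properties
  using (∈-allFin; ∈-filter⁺; ∈-map⁺; ∈-map∘filter⁻)
open import Data.List.Extrema.Nat using (min; min≤xs; argmin-sel)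
import Data.Nat as ℕ
import Data.Nat.Properties as ℕ
import Data.Integer as ℤ
open import Data.Integer using (+_; +≤+)
open import Data.Integer.Properties using (drop‿+≤+; neg-mono-≤; neg-cancel-≤; *-identityʳ)
open import Data.Rational using (*≤*; _≤?_)
import Data.Rational as ℚ
open import Data.Rational.Literals using (fromℤ)
open import Data.Rational.Properties using (≤-trans; ≤-total; ≰⇒>; <-irrefl; module ≤-Reasoning)
open import Relation.Binary.Core using (Rel)
import Relation.Binary.Reasoning.Setoid as SetoidReasoning
open import Relation.Binary.Definitions using (Transitive; Total; Decidable)
open import Relation.Nullary using (Dec; yes; no; does; ¬_; contradiction)
open import Relation.Binary.PropositionalEquality
  using (_≡_; refl; sym; trans; cong; subst; subst₂)

private
  variable
    a ℓ : Level
    A : Set a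
    m n : ℕ

  module ⇔-Reasoning = SetoidReasoning (⇔-setoid 0ℓ)

does≡true⇔ : {P : Set a} (P? : Dec P) → does P? ≡ true ⇔ P
does≡true⇔ (yes p) = mk⇔ (λ _ → p) (λ _ → refl)
does≡true⇔ (no ¬p) = mk⇔ (λ ()) (λ p → contradiction p ¬p)

∧≡true⇔ : ∀ {b c} → b ∧ c ≡ true ⇔ (b ≡ true × c ≡ true)
∧≡true⇔ {true}  {true}  = mk⇔ (λ _ → refl , refl) (λ _ → refl)
∧≡true⇔ {true}  {false} = mk⇔ (λ ()) (λ ())
∧≡true⇔ {false} {c}     = mk⇔ (λ ()) (λ ())

negative-¬Meets : ∀ {I J} → Negative I → Negative J → ¬ Meets I J
negative-¬Meets {I} {J} I⁻ J⁻ (lI≤rJ , lJ≤rI) = <-irrefl refl (begin-strict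
  r I  <⟨ I⁻ ⟩
  l I  ≤⟨ lI≤rJ ⟩
  r J  <⟨ J⁻ ⟩
  l J  ≤⟨ lJ≤rI ⟩
  r I  ∎)
  where open ≤-Reasoning

SAdj⇔Meets : ∀ I J → SAdj I J ⇔ Meets I J
SAdj⇔Meets I J = mk⇔ to from
  where
  to : SAdj I J → Meets I J
  to (inj₁ (_ , _ , meets))                = meets
  to (inj₂ (inj₁ (_ , _ , (lJ≤rI , lI≤rJ)))) = lI≤rJ , lJ≤rI
  to (inj₂ (inj₂ (_ , _ , meets)))         = meets
  from : Meets I J → SAdj I J
  from meets@(lI≤rJ , lJ≤rI) with l I ≤? r I | l J ≤? r J
  ... | yes I⁺ | yes J⁺ = inj₁ (I⁺ , J⁺ , meets)
  ... | no  I⁻ | yes J⁺ = inj₂ (inj₁ (≰⇒> I⁻ , J⁺ , (lJ≤rI , lI≤rJ)))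
  ... | yes I⁺ | no  J⁻ = inj₂ (inj₂ (≰⇒> J⁻ , I⁺ , meets))
  ... | no  I⁻ | no  J⁻ = contradiction meets (negative-¬Meets (≰⇒> I⁻) (≰⇒> J⁻))

IsThreshold : Rel A ℓ → BiGraph m n → Set _
IsThreshold {A = A} {m = m} {n = n} _≼_ F =
  Σ[ w ∈ (Fin m → A) ] Σ[ t ∈ (Fin n → A) ] (∀ x y → F x y ≡ true ⇔ t y ≼ w x)

does-isThreshold : {_≼_ : Rel A ℓ} (_≼?_ : Decidable _≼_) (w : Fin m → A) (t : Fin n → A) →
                   IsThreshold _≼_ (λ x y → does (t y ≼? w x))
does-isThreshold _≼?_ w t = w , t , λ x y → does≡true⇔ (t y ≼? w x)

threshold⇒ferrers : {_≼_ : Rel A ℓ} → Transitive _≼_ → Total _≼_ →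
                    {F : BiGraph m n} → IsThreshold _≼_ F → IsFerrers F
threshold⇒ferrers {_≼_ = _≼_} ≼-trans ≼-total {F} (w , t , F⇔) x x′ =
  Sum.map (neighbourhood-mono x x′) (neighbourhood-mono x′ x) (≼-total (w x) (w x′))
  where
  neighbourhood-mono : ∀ u v → w u ≼ w v → ∀ y → F u y ≡ true → F v y ≡ true
  neighbourhood-mono u v wu≼wv y =
    Equivalence.from (F⇔ v y) ∘ flip ≼-trans wu≼wv ∘ Equivalence.to (F⇔ u y)

∈-tabulate⇔ : ∀ {f : Fin n → Bool} {y} → y Subset.∈ tabulate f ⇔ f y ≡ true
∈-tabulate⇔ {f = f} {y} = mk⇔
  (λ y∈ → trans (sym (lookup∘tabulate f y)) ([]=⇒lookup y∈))
  (λ fy → lookup⇒[]= y (tabulate f) (trans (lookup∘tabulate f y) fy))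

∣p∣≤∣q∣⇒p⊆q : ∀ {p q : Subset n} → p ⊆ q ⊎ q ⊆ p → ∣ p ∣ ℕ.≤ ∣ q ∣ → p ⊆ q
∣p∣≤∣q∣⇒p⊆q (inj₁ p⊆q) _ = p⊆q
∣p∣≤∣q∣⇒p⊆q {q = q} (inj₂ q⊆p) ∣p∣≤∣q∣ {y} y∈p with y ∈? q
... | yes y∈q = y∈q
... | no  y∉q = contradiction (p⊂q⇒∣p∣<∣q∣ (q⊆p , y , y∈p , y∉q)) (ℕ.≤⇒≯ ∣p∣≤∣q∣)

neighbourhood : BiGraph m n → Fin m → Subset n
neighbourhood F x = tabulate (F x)

module _ {F : BiGraph m n} (ferrers : IsFerrers F) where

  private
    N : Fin m → Subset n
    N = neighbourhood F

  ferrers-⊆-total : ∀ x x′ → N x ⊆ N x′ ⊎ N x′ ⊆ N x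
  ferrers-⊆-total x x′ = Sum.map lift lift (ferrers x x′)
    where
    lift : ∀ {u v} → (∀ y → F u y ≡ true → F v y ≡ true) → N u ⊆ N v
    lift sub {y} = Equivalence.from ∈-tabulate⇔ ∘ sub y ∘ Equivalence.to ∈-tabulate⇔

  ferrers-∣N∣-mono : ∀ {x x′ y} → ∣ N x ∣ ℕ.≤ ∣ N x′ ∣ → F x y ≡ true → F x′ y ≡ true
  ferrers-∣N∣-mono {x} {x′} ∣Nx∣≤∣Nx′∣ =
    Equivalence.to ∈-tabulate⇔ ∘ ∣p∣≤∣q∣⇒p⊆q (ferrers-⊆-total x x′) ∣Nx∣≤∣Nx′∣ ∘ Equivalence.from ∈-tabulate⇔

  -- The default suc n of the minimum exceeds every ∣N x∣, so an isolated y
  -- stays isolated.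
  ferrers⇒threshold : IsThreshold ℕ._≤_ F
  ferrers⇒threshold = w , t , λ x y → mk⇔ (adjacent⇒t≤w x y) (t≤w⇒adjacent x y)
    where
    w : Fin m → ℕ
    w x = ∣ N x ∣
    adjacent? : ∀ y (x : Fin m) → Dec (F x y ≡ true)
    adjacent? y x = F x y ≟ true
    neighbours : Fin n → List (Fin m)
    neighbours y = filter (adjacent? y) (allFin m)
    t : Fin n → ℕ
    t y = min (ℕ.suc n) (map w (neighbours y))

    adjacent⇒t≤w : ∀ x y → F x y ≡ true → t y ℕ.≤ w x
    adjacent⇒t≤w x y Fxy = All.lookup (min≤xs (ℕ.suc n) _)
      (∈-map⁺ w (∈-filter⁺ (adjacent? y) (∈-allFin x) Fxy))

    t≤w⇒adjacent : ∀ x y → t y ℕ.≤ w x → F x y ≡ true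
    t≤w⇒adjacent x y ty≤wx with argmin-sel id (ℕ.suc n) (map w (neighbours y))
    ... | inj₁ ty≡1+n =
      contradiction (subst (ℕ._≤ w x) ty≡1+n ty≤wx) (ℕ.<⇒≱ (ℕ.s≤s (∣p∣≤n (N x))))
    ... | inj₂ ty∈ with ∈-map∘filter⁻ w (adjacent? y) {xs = allFin m} ty∈
    ...   | x′ , _ , ty≡wx′ , Fx′y = ferrers-∣N∣-mono (subst (ℕ._≤ w x) ty≡wx′ ty≤wx) Fx′y

fromℤ-≤⇔ : ∀ {i j} → fromℤ i ℚ.≤ fromℤ j ⇔ i ℤ.≤ j
fromℤ-≤⇔ {i} {j} = mk⇔
  (λ { (*≤* i*1≤j*1) → subst₂ ℤ._≤_ (*-identityʳ i) (*-identityʳ j) i*1≤j*1 })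
  (λ i≤j → *≤* (subst₂ ℤ._≤_ (sym (*-identityʳ i)) (sym (*-identityʳ j)) i≤j))

+≤+⇔ : ∀ {i j} → + i ℤ.≤ + j ⇔ i ℕ.≤ j
+≤+⇔ = mk⇔ drop‿+≤+ +≤+

neg-≤⇔ : ∀ {i j} → ℤ.- i ℤ.≤ ℤ.- j ⇔ j ℤ.≤ i
neg-≤⇔ = mk⇔ neg-cancel-≤ neg-mono-≤

signedInterval⇒ferrersDim≤2 : (E : BiGraph m n) → IsSignedIntervalBigraph E → FerrersDim≤2 E
signedInterval⇒ferrersDim≤2 {m} {n} E (I , J , adj) =
  F₁ , F₂ , F₁-ferrers , F₂-ferrers , λ x y → ⇔→≡ (E⇔F₁∧F₂ x y)
  where
  F₁ F₂ : BiGraph m n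
  F₁ x y = does (l (I x) ≤? r (J y))
  F₂ x y = does (l (J y) ≤? r (I x))

  F₁-ferrers : IsFerrers F₁
  F₁-ferrers = threshold⇒ferrers (flip ≤-trans) (flip ≤-total)
                 (does-isThreshold (flip _≤?_) (l ∘ I) (r ∘ J))

  F₂-ferrers : IsFerrers F₂
  F₂-ferrers = threshold⇒ferrers ≤-trans ≤-total (does-isThreshold _≤?_ (r ∘ I) (l ∘ J))

  E⇔F₁∧F₂ : ∀ x y → E x y ≡ true ⇔ (F₁ x y ∧ F₂ x y) ≡ true
  E⇔F₁∧F₂ x y = begin
    E x y ≡ true                       ≈⟨ uncurry mk⇔ (adj x y) ⟩
    SAdj (I x) (J y)                   ≈⟨ SAdj⇔Meets (I x) (J y) ⟩
    Meets (I x) (J y)                  ≈⟨ does≡true⇔ (_ ≤? _) ×-⇔ does≡true⇔ (_ ≤? _) ⟨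
    (F₁ x y ≡ true × F₂ x y ≡ true)    ≈⟨ ∧≡true⇔ ⟨
    (F₁ x y ∧ F₂ x y) ≡ true           ∎
    where open ⇔-Reasoning

ferrersDim≤2⇒signedInterval : (E : BiGraph m n) → FerrersDim≤2 E → IsSignedIntervalBigraph E
ferrersDim≤2⇒signedInterval {m} {n} E (F₁ , F₂ , F₁-ferrers , F₂-ferrers , E≡F₁∧F₂)
  with ferrers⇒threshold F₁-ferrers | ferrers⇒threshold F₂-ferrers
... | w₁ , t₁ , F₁⇔ | w₂ , t₂ , F₂⇔ = I , J , λ x y → let open Equivalence (E⇔SAdj x y) in to , from
  where
  I : Fin m → SInterval
  I x = [ fromℤ (ℤ.- + w₁ x) , fromℤ (+ w₂ x) ]
  J : Fin n → SInterval
  J y = [ fromℤ (+ t₂ y) , fromℤ (ℤ.- + t₁ y) ]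

  E⇔SAdj : ∀ x y → E x y ≡ true ⇔ SAdj (I x) (J y)
  E⇔SAdj x y = begin
    E x y ≡ true                                      ≡⟨ cong (_≡ true) (E≡F₁∧F₂ x y) ⟩
    (F₁ x y ∧ F₂ x y) ≡ true                          ≈⟨ ∧≡true⇔ ⟩
    (F₁ x y ≡ true × F₂ x y ≡ true)                   ≈⟨ F₁⇔ x y ×-⇔ F₂⇔ x y ⟩
    (t₁ y ℕ.≤ w₁ x × t₂ y ℕ.≤ w₂ x)                   ≈⟨ (+≤+⇔ ⇔-∘ neg-≤⇔) ×-⇔ +≤+⇔ ⟨
    (ℤ.- + w₁ x ℤ.≤ ℤ.- + t₁ y × + t₂ y ℤ.≤ + w₂ x)   ≈⟨ fromℤ-≤⇔ ×-⇔ fromℤ-≤⇔ ⟨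
    Meets (I x) (J y)                                 ≈⟨ SAdj⇔Meets (I x) (J y) ⟨
    SAdj (I x) (J y)                                  ∎
    where open ⇔-Reasoning

theorem8 : (m n : ℕ) (E : BiGraph m n) → IsSignedIntervalBigraph E ⇔ FerrersDim≤2 E
theorem8 m n E = mk⇔ (signedInterval⇒ferrersDim≤2 E) (ferrersDim≤2⇒signedInterval E)
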